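{- For a graph $G$, $\operatorname{Z}^*(G)=1$ if and only if $G$ is a path graph.
   Context: Graphs are finite, simple, undirected with nonempty vertex sets. A fort of $G$ is a nonempty $F\subseteq V(G)$ such that every $v\in V(G)\setminus F$ has $|N_G(v)\cap F|\neq 1$; a minimal fort is one not properly containing another fort. $\operatorname{Z}^*(G)=\min\{\sum_{v\in V(G)}x_v : \sum_{v\in F}x_v\ge 1 \text{ for every minimal fort } F \text{ of } G,\ x_v\ge 0\}$.
   Formalization: The weights $x_v$ in the linear program defining $\operatorname{Z}^*(G)$ range over the rationals. -}

module Defs where

open import Data.Nat using (ℕ; zero; suc; _<_)
open import Data.Fin using (Fin; zero; suc; toℕ)
open import Data.Bool using (Bool; true; false; _∧_; if_then_else_)
open import Data.Rational using (ℚ; 0ℚ; 1ℚ; _+_; _≤_)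
open import Data.Product using (Σ; ∃; _×_)
open import Data.Sum using (_⊎_)
open import Relation.Binary.PropositionalEquality using (_≡_; _≢_)
open import Function.Definitions using (Injective)
open import Function.Bundles using (_⇔_)

record Graph : Set where
  field
    n        : ℕ
    nonempty : 0 < n
    adj      : Fin n → Fin n → Bool
    adj-sym  : ∀ u v → adj u v ≡ adj v u
    irrefl   : ∀ v → adj v v ≡ false
open Graph public

sumℚ : ∀ {n} → (Fin n → ℚ) → ℚ
sumℚ {zero}  f = 0ℚ
sumℚ {suc n} f = f zero + sumℚ (λ i → f (suc i))

count : ∀ {n} → (Fin n → Bool) → ℕ
count {zero}  p = 0
count {suc n} p with p zero
... | true  = suc (count (λ i → p (suc i)))
... | false = count (λ i → p (suc i))

VSet : Graph → Set
VSet G = Fin (n G) → Bool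

IsFort : (G : Graph) → VSet G → Set
IsFort G F =
  (∃ λ v → F v ≡ true) ×
  (∀ v → F v ≡ false → count (λ u → adj G v u ∧ F u) ≢ 1)

IsMinimalFort : (G : Graph) → VSet G → Set
IsMinimalFort G F =
  IsFort G F ×
  (∀ F' → IsFort G F' → (∀ v → F' v ≡ true → F v ≡ true) →
          ∀ v → F v ≡ true → F' v ≡ true)

-- feasibility for the fractional zero forcing LP
Feasible : (G : Graph) → (Fin (n G) → ℚ) → Set
Feasible G x =
  (∀ v → 0ℚ ≤ x v) ×
  (∀ F → IsMinimalFort G F → 1ℚ ≤ sumℚ (λ v → if F v then x v else 0ℚ))

ZStarIsOne : Graph → Set
ZStarIsOne G =
  (∃ λ x → Feasible G x × sumℚ x ≡ 1ℚ) ×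
  (∀ x → Feasible G x → 1ℚ ≤ sumℚ x)

-- G is a path graph: its vertices can be ordered (bijectively, via an
-- injection Fin n → Fin n) so that u ~ v iff their positions differ by 1
IsPath : Graph → Set
IsPath G =
  Σ (Fin (n G) → Fin (n G)) λ σ →
    Injective _≡_ _≡_ σ ×
    (∀ u v → (adj G u v ≡ true) ⇔
             (suc (toℕ (σ u)) ≡ toℕ (σ v) ⊎ suc (toℕ (σ v)) ≡ toℕ (σ u)))

module Submission where

open import Defs
open import Algebra.Bundles using (CommutativeMonoid)
import Algebra.Properties.CommutativeSemigroup as CommSemigroupProperties
open import Data.Bool using (Bool; true; false; _∧_; if_then_else_; not)
import Data.Bool as Bool
open import Data.Bool.Properties using (¬-not)
open import Data.Empty using (⊥; ⊥-elim)
open import Data.Fin using (Fin; zero; suc; toℕ; fromℕ; fromℕ<; cast; punchOut)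
open import Data.Fin.Properties
  using (any?; all?; suc-injective; toℕ-injective; toℕ-cast; toℕ-fromℕ<; toℕ<n;
         injective⇒≤; cantor-schröder-bernstein; punchOut-injective; 0≢1+n)
  renaming (_≟_ to _≟ᶠ_)
open import Data.Fin.Subset.Properties using (anySubset?)
open import Data.Nat using (ℕ; zero; suc; _+_; _≤_; _<_; z≤n; s≤s; _∸_)
import Data.Nat as ℕ
open import Data.Nat.Properties
  using (≤-refl; ≤-trans; <-≤-trans; <-irrefl; ≤-pred; m≤n⇒m≤1+n; m<n⇒m<1+n;
         m≤n⇒m<n∨m≡n; n≤1+n; <⇒≤; n≤0⇒n≡0; +-suc; m∸n+n≡m)
import Data.Nat.Properties as ℕ
open import Data.Product using (∃; _×_; _,_; proj₁; proj₂)
import Data.Product as Product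
open import Data.Rational using (ℚ; 0ℚ; 1ℚ) renaming (_+_ to _+ℚ_; _≤_ to _≤ℚ_; _<_ to _<ℚ_)
import Data.Rational as ℚ
import Data.Rational.Properties as ℚ
open import Data.Sum using (_⊎_; inj₁; inj₂; swap; [_,_]′)
import Data.Sum as Sum
open import Data.Vec using (lookup; tabulate)
open import Data.Vec.Properties using (lookup∘tabulate)
open import Function using (_∘_; id; case_of_)
open import Function.Bundles using (_⇔_; mk⇔; Equivalence)
open import Function.Construct.Composition using (_⇔-∘_)
open import Function.Definitions using (Injective)
open import Relation.Nullary using (Dec; yes; no; ¬_; does)
open import Relation.Nullary.Decidable using (_×-dec_; _→-dec_; ¬?; toWitness; dec-true; dec-false; decidable-stable)
open import Relation.Binary.PropositionalEquality
  using (_≡_; _≢_; refl; sym; trans; cong; subst; subst₂)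

-- Both sides are equivalent to the existence of a vertex lying in every fort.
-- V(G) is a fort, so every feasible weighting has total weight at least 1; a
-- vertex of positive weight in an optimum of weight 1 lies in every minimal
-- fort (a fort missing it would have weight below 1), and conversely the unit
-- weight on a vertex lying in every fort is feasible.  In a path, an endpoint
-- lies in every fort: if it were missed, the fort condition would propagate
-- along the path and empty the fort.  Conversely, grow a path from a vertex v
-- lying in every fort, keeping all neighbours of its interior vertices on it:
-- the complement of such a path misses v, so it is not a fort, which forces
-- the free end to have exactly one neighbour off the path.

count-cong : ∀ {m} {p q : Fin m → Bool} → (∀ i → p i ≡ q i) → count p ≡ count q
count-cong {zero}              p≗q = refl
count-cong {suc m} {p} {q} p≗q with p zero | q zero | p≗q zero
... | true  | true  | _ = cong suc (count-cong (p≗q ∘ suc))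
... | false | false | _ = count-cong (p≗q ∘ suc)

all-false⇒count≡0 : ∀ {m} (p : Fin m → Bool) → (∀ i → p i ≡ false) → count p ≡ 0
all-false⇒count≡0 {zero}  p p≡false = refl
all-false⇒count≡0 {suc m} p p≡false with p zero | p≡false zero
... | false | _ = all-false⇒count≡0 (p ∘ suc) (p≡false ∘ suc)

count≡0⇒all-false : ∀ {m} (p : Fin m → Bool) → count p ≡ 0 → ∀ i → p i ≡ false
count≡0⇒all-false {suc m} p c i with p zero in p₀
count≡0⇒all-false {suc m} p c zero    | false = p₀
count≡0⇒all-false {suc m} p c (suc i) | false = count≡0⇒all-false (p ∘ suc) c i

∧≡true⇒ : ∀ {a b} → a ∧ b ≡ true → a ≡ true × b ≡ true
∧≡true⇒ {true} {true} _ = refl , refl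

∧-intro : ∀ {a b} → a ≡ true → b ≡ true → a ∧ b ≡ true
∧-intro refl refl = refl

unique⇒count≡1 : ∀ {m} (p : Fin m → Bool) u → p u ≡ true →
                 (∀ w → p w ≡ true → w ≡ u) → count p ≡ 1
unique⇒count≡1 {suc m} p zero pu unique with p zero
... | true = cong suc (all-false⇒count≡0 (p ∘ suc) λ i → ¬-not λ p₁₊ᵢ → 0≢1+n (sym (unique (suc i) p₁₊ᵢ)))
unique⇒count≡1 {suc m} p (suc u) pu unique with p zero in p₀
... | true with () ← unique zero p₀
... | false = unique⇒count≡1 (p ∘ suc) u pu (λ w pw → suc-injective (unique (suc w) pw))

count≡1⇒unique : ∀ {m} (p : Fin m → Bool) → count p ≡ 1 →
                 ∃ λ u → p u ≡ true × (∀ w → p w ≡ true → w ≡ u)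
count≡1⇒unique {suc m} p c with p zero in p₀
... | true = zero , p₀ , unique
  where
  unique : ∀ w → p w ≡ true → w ≡ zero
  unique zero    _  = refl
  unique (suc w) pw with () ← trans (sym pw) (count≡0⇒all-false (p ∘ suc) (ℕ.suc-injective c) w)
... | false with count≡1⇒unique (p ∘ suc) c
...   | u , pu , unique = suc u , pu , unique′
  where
  unique′ : ∀ w → p w ≡ true → w ≡ suc u
  unique′ zero    pw with () ← trans (sym pw) p₀
  unique′ (suc w) pw = cong suc (unique w pw)

count-mono-≤ : ∀ {m} (p q : Fin m → Bool) → (∀ i → p i ≡ true → q i ≡ true) → count p ≤ count q
count-mono-≤ {zero}  p q p⊆q = z≤n
count-mono-≤ {suc m} p q p⊆q with p zero in p₀ | q zero in q₀
... | true  | true  = s≤s (count-mono-≤ (p ∘ suc) (q ∘ suc) (p⊆q ∘ suc))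
... | false | true  = m≤n⇒m≤1+n (count-mono-≤ (p ∘ suc) (q ∘ suc) (p⊆q ∘ suc))
... | false | false = count-mono-≤ (p ∘ suc) (q ∘ suc) (p⊆q ∘ suc)
... | true  | false with () ← trans (sym (p⊆q zero p₀)) q₀

count-mono-< : ∀ {m} (p q : Fin m → Bool) → (∀ i → p i ≡ true → q i ≡ true) →
               ∀ v → q v ≡ true → p v ≡ false → count p < count q
count-mono-< {suc m} p q p⊆q zero qv pv with p zero | q zero
... | false | true  = s≤s (count-mono-≤ (p ∘ suc) (q ∘ suc) (p⊆q ∘ suc))
count-mono-< {suc m} p q p⊆q (suc v) qv pv with p zero in p₀ | q zero in q₀
... | true  | true  = s≤s (count-mono-< (p ∘ suc) (q ∘ suc) (p⊆q ∘ suc) v qv pv)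
... | false | true  = m<n⇒m<1+n (count-mono-< (p ∘ suc) (q ∘ suc) (p⊆q ∘ suc) v qv pv)
... | false | false = count-mono-< (p ∘ suc) (q ∘ suc) (p⊆q ∘ suc) v qv pv
... | true  | false with () ← trans (sym (p⊆q zero p₀)) q₀

injective⇒surjective : ∀ {m} (σ : Fin m → Fin m) → Injective _≡_ _≡_ σ → ∀ j → ∃ λ u → σ u ≡ j
injective⇒surjective {suc m} σ σ-inj j with any? (λ u → σ u ≟ᶠ j)
... | yes hit = hit
... | no  miss = ⊥-elim (<-irrefl refl (injective⇒≤ {f = σ∖j} σ∖j-injective))
  where
  σ∖j : Fin (suc m) → Fin m
  σ∖j u = punchOut {i = j} {j = σ u} (λ j≡σu → miss (u , sym j≡σu))
  σ∖j-injective : Injective _≡_ _≡_ σ∖j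
  σ∖j-injective = σ-inj ∘ punchOut-injective {i = j} _ _

module Forts (G : Graph) where

  _⊆_ : VSet G → VSet G → Set
  A ⊆ B = ∀ v → A v ≡ true → B v ≡ true

  InEveryFort : Fin (n G) → Set
  InEveryFort v = ∀ F → IsFort G F → F v ≡ true

  isFort? : ∀ F → Dec (IsFort G F)
  isFort? F = any? (λ v → F v Bool.≟ true)
       ×-dec all? (λ v → (F v Bool.≟ false) →-dec ¬? (count (λ u → adj G v u ∧ F u) ℕ.≟ 1))

  isFort-cong : ∀ {F F′} → (∀ v → F v ≡ F′ v) → IsFort G F → IsFort G F′
  isFort-cong F≗F′ ((v , Fv) , outside) =
    (v , trans (sym (F≗F′ v)) Fv) ,
    λ u F′u → outside u (trans (F≗F′ u) F′u) ∘ trans (count-cong λ w → cong (adj G u w ∧_) (F≗F′ w))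

  V-isFort : IsFort G (λ _ → true)
  V-isFort = (fromℕ< (nonempty G) , refl) , λ _ ()

  ProperSubfort : VSet G → VSet G → Set
  ProperSubfort F F′ = IsFort G F′ × F′ ⊆ F × ∃ λ v → F v ≡ true × F′ v ≡ false

  properSubfort? : ∀ F F′ → Dec (ProperSubfort F F′)
  properSubfort? F F′ = isFort? F′
    ×-dec all? (λ v → (F′ v Bool.≟ true) →-dec (F v Bool.≟ true))
    ×-dec any? (λ v → (F v Bool.≟ true) ×-dec (F′ v Bool.≟ false))

  properSubfort-cong : ∀ {F F′ F″} → (∀ v → F′ v ≡ F″ v) → ProperSubfort F F′ → ProperSubfort F F″
  properSubfort-cong F′≗F″ (F′-fort , F′⊆F , v , Fv , F′v) =
    isFort-cong F′≗F″ F′-fort , (λ u F″u → F′⊆F u (trans (F′≗F″ u) F″u)) ,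
    v , Fv , trans (sym (F′≗F″ v)) F′v

  -- Subsets of V(G) are enumerated as vectors, so having a proper subfort is decidable.
  hasProperSubfort? : ∀ F → Dec (∃ (ProperSubfort F))
  hasProperSubfort? F with anySubset? (properSubfort? F ∘ lookup)
  ... | yes (S , S<F) = yes (lookup S , S<F)
  ... | no  none      = no λ (F′ , F′<F) →
    none (tabulate F′ , properSubfort-cong (sym ∘ lookup∘tabulate F′) F′<F)

  noProperSubfort⇒minimal : ∀ F → IsFort G F → ¬ ∃ (ProperSubfort F) → IsMinimalFort G F
  noProperSubfort⇒minimal F F-fort none =
    F-fort , λ F′ F′-fort F′⊆F v Fv → ¬-not λ F′v≡false → none (F′ , F′-fort , F′⊆F , v , Fv , F′v≡false)

  minimalFort-⊆-bounded : ∀ m F → count F < m → IsFort G F → ∃ λ F′ → IsMinimalFort G F′ × F′ ⊆ F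
  minimalFort-⊆-bounded (suc m) F F<1+m F-fort with hasProperSubfort? F
  ... | no none = F , noProperSubfort⇒minimal F F-fort none , λ _ Fv → Fv
  ... | yes (F′ , F′-fort , F′⊆F , v , Fv , F′v)
    with minimalFort-⊆-bounded m F′ (<-≤-trans (count-mono-< F′ F F′⊆F v Fv F′v) (≤-pred F<1+m)) F′-fort
  ...   | F″ , F″-minimal , F″⊆F′ = F″ , F″-minimal , λ u → F′⊆F u ∘ F″⊆F′ u

  minimalFort-⊆ : ∀ F → IsFort G F → ∃ λ F′ → IsMinimalFort G F′ × F′ ⊆ F
  minimalFort-⊆ F = minimalFort-⊆-bounded (suc (count F)) F ≤-refl

  inEveryMinimalFort⇒inEveryFort : ∀ v → (∀ F → IsMinimalFort G F → F v ≡ true) → InEveryFort v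
  inEveryMinimalFort⇒inEveryFort v v∈min F F-fort with minimalFort-⊆ F F-fort
  ... | F′ , F′-minimal , F′⊆F = F′⊆F v (v∈min F′ F′-minimal)

sumℚ-mono-≤ : ∀ {m} (f g : Fin m → ℚ) → (∀ i → f i ≤ℚ g i) → sumℚ f ≤ℚ sumℚ g
sumℚ-mono-≤ {zero}  f g f≤g = ℚ.≤-refl
sumℚ-mono-≤ {suc m} f g f≤g = ℚ.+-mono-≤ (f≤g zero) (sumℚ-mono-≤ (f ∘ suc) (g ∘ suc) (f≤g ∘ suc))

sumℚ-mono-≤-at : ∀ {m} (f g : Fin m → ℚ) d v → (∀ i → f i ≤ℚ g i) → f v +ℚ d ≤ℚ g v →
                 sumℚ f +ℚ d ≤ℚ sumℚ g
sumℚ-mono-≤-at {suc m} f g d zero f≤g fv+d≤gv = begin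
  (f zero +ℚ sumℚ (f ∘ suc)) +ℚ d  ≡⟨ xy∙z≈xz∙y (f zero) (sumℚ (f ∘ suc)) d ⟩
  (f zero +ℚ d) +ℚ sumℚ (f ∘ suc)  ≤⟨ ℚ.+-mono-≤ fv+d≤gv (sumℚ-mono-≤ (f ∘ suc) (g ∘ suc) (f≤g ∘ suc)) ⟩
  g zero +ℚ sumℚ (g ∘ suc)         ∎
  where open ℚ.≤-Reasoning
        open CommSemigroupProperties (CommutativeMonoid.commutativeSemigroup ℚ.+-0-commutativeMonoid)
sumℚ-mono-≤-at {suc m} f g d (suc v) f≤g fv+d≤gv = begin
  (f zero +ℚ sumℚ (f ∘ suc)) +ℚ d  ≡⟨ ℚ.+-assoc (f zero) (sumℚ (f ∘ suc)) d ⟩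
  f zero +ℚ (sumℚ (f ∘ suc) +ℚ d)  ≤⟨ ℚ.+-mono-≤ (f≤g zero) (sumℚ-mono-≤-at (f ∘ suc) (g ∘ suc) d v (f≤g ∘ suc) fv+d≤gv) ⟩
  g zero +ℚ sumℚ (g ∘ suc)         ∎
  where open ℚ.≤-Reasoning

sumℚ-0ℚ : ∀ m → sumℚ {m} (λ _ → 0ℚ) ≡ 0ℚ
sumℚ-0ℚ zero    = refl
sumℚ-0ℚ (suc m) = trans (ℚ.+-identityˡ _) (sumℚ-0ℚ m)

indicator : ∀ {m} → Fin m → Fin m → ℚ
indicator e u = if does (u ≟ᶠ e) then 1ℚ else 0ℚ

sumℚ-indicator : ∀ {m} (e : Fin m) → sumℚ (indicator e) ≡ 1ℚ
sumℚ-indicator {suc m} zero    = trans (cong (1ℚ +ℚ_) (sumℚ-0ℚ m)) (ℚ.+-identityʳ 1ℚ)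
sumℚ-indicator {suc m} (suc e) = trans (ℚ.+-identityˡ _) (sumℚ-indicator e)

restrict : ∀ {m} → (Fin m → Bool) → (Fin m → ℚ) → Fin m → ℚ
restrict F x v = if F v then x v else 0ℚ

restrict-≤ : ∀ {m} (F : Fin m → Bool) (x : Fin m → ℚ) → (∀ v → 0ℚ ≤ℚ x v) → ∀ v → restrict F x v ≤ℚ x v
restrict-≤ F x x≥0 v with F v
... | true  = ℚ.≤-refl
... | false = x≥0 v

point≤sumℚ : ∀ {m} (f : Fin m → ℚ) v → (∀ i → 0ℚ ≤ℚ f i) → f v ≤ℚ sumℚ f
point≤sumℚ {m} f v f≥0 = begin
  f v                         ≡⟨ sym (ℚ.+-identityˡ (f v)) ⟩
  0ℚ +ℚ f v                   ≡⟨ cong (_+ℚ f v) (sym (sumℚ-0ℚ m)) ⟩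
  sumℚ {m} (λ _ → 0ℚ) +ℚ f v  ≤⟨ sumℚ-mono-≤-at _ f (f v) v f≥0 (ℚ.≤-reflexive (ℚ.+-identityˡ (f v))) ⟩
  sumℚ f                      ∎
  where open ℚ.≤-Reasoning

0<1 : 0ℚ <ℚ 1ℚ
0<1 = toWitness {a? = 0ℚ ℚ.<? 1ℚ} _

1≤sumℚ⇒positive-entry : ∀ {m} (x : Fin m → ℚ) → 1ℚ ≤ℚ sumℚ x → ∃ λ v → 0ℚ <ℚ x v
1≤sumℚ⇒positive-entry {m} x 1≤Σx with any? (λ v → 0ℚ ℚ.<? x v)
... | yes positive = positive
... | no  none     = ⊥-elim (ℚ.<-irrefl refl (ℚ.<-≤-trans 0<1 (begin
  1ℚ                   ≤⟨ 1≤Σx ⟩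
  sumℚ x               ≤⟨ sumℚ-mono-≤ x (λ _ → 0ℚ) (λ v → ℚ.≮⇒≥ (λ 0<xv → none (v , 0<xv))) ⟩
  sumℚ {m} (λ _ → 0ℚ)  ≡⟨ sumℚ-0ℚ m ⟩
  0ℚ                   ∎)))
  where open ℚ.≤-Reasoning

indicator-self : ∀ {m} (e : Fin m) → indicator e e ≡ 1ℚ
indicator-self e rewrite dec-true (e ≟ᶠ e) refl = refl

indicator-nonneg : ∀ {m} (e u : Fin m) → 0ℚ ≤ℚ indicator e u
indicator-nonneg e u with does (u ≟ᶠ e)
... | true  = ℚ.<⇒≤ 0<1
... | false = ℚ.≤-refl

restrict-nonneg : ∀ {m} (F : Fin m → Bool) (x : Fin m → ℚ) → (∀ v → 0ℚ ≤ℚ x v) → ∀ v → 0ℚ ≤ℚ restrict F x v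
restrict-nonneg F x x≥0 v with F v
... | true  = x≥0 v
... | false = ℚ.≤-refl

module FractionalZeroForcing (G : Graph) where
  open Forts G

  feasible⇒1≤sumℚ : ∀ x → Feasible G x → 1ℚ ≤ℚ sumℚ x
  feasible⇒1≤sumℚ x (x≥0 , covers) with minimalFort-⊆ (λ _ → true) V-isFort
  ... | F , F-minimal , _ = ℚ.≤-trans (covers F F-minimal) (sumℚ-mono-≤ _ x (restrict-≤ F x x≥0))

  indicator-feasible : ∀ v → InEveryFort v → Feasible G (indicator v)
  indicator-feasible v v∈forts = indicator-nonneg v , λ F F-minimal → begin
    1ℚ                               ≡⟨ sym (indicator-self v) ⟩
    indicator v v                    ≡⟨ cong (λ b → if b then indicator v v else 0ℚ) (sym (v∈forts F (proj₁ F-minimal))) ⟩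
    restrict F (indicator v) v       ≤⟨ point≤sumℚ _ v (restrict-nonneg F _ (indicator-nonneg v)) ⟩
    sumℚ (restrict F (indicator v))  ∎
    where open ℚ.≤-Reasoning

  inEveryFort⇒ZStarIsOne : ∀ v → InEveryFort v → ZStarIsOne G
  inEveryFort⇒ZStarIsOne v v∈forts =
    (indicator v , indicator-feasible v v∈forts , sumℚ-indicator v) , feasible⇒1≤sumℚ

  -- A minimal fort F missing v has weight at most Σx − x v < 1.
  positive-weight-in-optimum⇒inEveryFort : ∀ x → Feasible G x → sumℚ x ≡ 1ℚ →
                                           ∀ v → 0ℚ <ℚ x v → InEveryFort v
  positive-weight-in-optimum⇒inEveryFort x (x≥0 , covers) Σx≡1 v 0<xv =
    inEveryMinimalFort⇒inEveryFort v λ F F-minimal → ¬-not λ Fv≡false →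
      ℚ.<-irrefl refl (begin-strict
        1ℚ                            ≡⟨ sym (ℚ.+-identityʳ 1ℚ) ⟩
        1ℚ +ℚ 0ℚ                      <⟨ ℚ.+-monoʳ-< 1ℚ 0<xv ⟩
        1ℚ +ℚ x v                     ≤⟨ ℚ.+-monoˡ-≤ (x v) (covers F F-minimal) ⟩
        sumℚ (restrict F x) +ℚ x v    ≤⟨ sumℚ-mono-≤-at _ x (x v) v (restrict-≤ F x x≥0) (missed F Fv≡false) ⟩
        sumℚ x                        ≡⟨ Σx≡1 ⟩
        1ℚ                            ∎)
    where
    open ℚ.≤-Reasoning
    missed : ∀ F → F v ≡ false → restrict F x v +ℚ x v ≤ℚ x v
    missed F Fv≡false rewrite Fv≡false = ℚ.≤-reflexive (ℚ.+-identityˡ (x v))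

  ZStarIsOne⇒inEveryFort : ZStarIsOne G → ∃ InEveryFort
  ZStarIsOne⇒inEveryFort ((x , x-feasible , Σx≡1) , _) =
    Product.map₂ (positive-weight-in-optimum⇒inEveryFort x x-feasible Σx≡1 _)
                 (1≤sumℚ⇒positive-entry x (ℚ.≤-reflexive (sym Σx≡1)))

Consecutive : ∀ {m} → Fin m → Fin m → Set
Consecutive i j = suc (toℕ i) ≡ toℕ j ⊎ suc (toℕ j) ≡ toℕ i

module PathEndpoint (G : Graph) (σ : Fin (n G) → Fin (n G)) (σ-injective : Injective _≡_ _≡_ σ)
  (adj⇔consecutive : ∀ u v → (adj G u v ≡ true) ⇔ Consecutive (σ u) (σ v)) where
  open Forts G

  position : Fin (n G) → ℕ
  position u = toℕ (σ u)

  position-injective : ∀ {u v} → position u ≡ position v → u ≡ v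
  position-injective = σ-injective ∘ toℕ-injective

  vertexAt : ∀ k → k < n G → ∃ λ u → position u ≡ k
  vertexAt k k<n with injective⇒surjective σ σ-injective (fromℕ< k<n)
  ... | u , σu≡k = u , trans (cong toℕ σu≡k) (toℕ-fromℕ< k<n)

  endpoint : Fin (n G)
  endpoint = proj₁ (vertexAt 0 (nonempty G))

  module _ (F : VSet G) (F-fort : IsFort G F) (endpoint∉F : F endpoint ≡ false) where

    OutsideUpTo : ℕ → Set
    OutsideUpTo k = ∀ u → position u ≤ k → F u ≡ false

    only-F-neighbour : ∀ k → OutsideUpTo k → ∀ a u → position a ≡ k → position u ≡ suc k →
                       ∀ w → adj G a w ∧ F w ≡ true → w ≡ u
    only-F-neighbour k outside a u a≡k u≡1+k w a~w∧Fw
      with Equivalence.to (adj⇔consecutive a w) (proj₁ (∧≡true⇒ a~w∧Fw))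
    ... | inj₁ 1+a≡w = position-injective (trans (sym 1+a≡w) (trans (cong suc a≡k) (sym u≡1+k)))
    ... | inj₂ 1+w≡a with () ← trans (sym (proj₂ (∧≡true⇒ a~w∧Fw)))
                                     (outside w (≤-trans (n≤1+n _) (ℕ.≤-reflexive (trans 1+w≡a a≡k))))

    -- If the vertex at position k + 1 were in F, it would be the only
    -- F-neighbour of the vertex at position k, which lies outside F.
    outsideUpTo-suc : ∀ k → OutsideUpTo k → OutsideUpTo (suc k)
    outsideUpTo-suc k outside u u≤1+k with m≤n⇒m<n∨m≡n u≤1+k
    ... | inj₁ u<1+k = outside u (≤-pred u<1+k)
    ... | inj₂ u≡1+k with vertexAt k (<⇒≤ (subst (_< n G) u≡1+k (toℕ<n (σ u))))
    ...   | a , a≡k = ¬-not λ Fu → proj₂ F-fort a (outside a (ℕ.≤-reflexive a≡k))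
      (unique⇒count≡1 _ u (∧-intro a~u Fu) (only-F-neighbour k outside a u a≡k u≡1+k))
      where
      a~u : adj G a u ≡ true
      a~u = Equivalence.from (adj⇔consecutive a u) (inj₁ (trans (cong suc a≡k) (sym u≡1+k)))

    outsideUpTo : ∀ k → OutsideUpTo k
    outsideUpTo zero    u u≤0 = subst (λ w → F w ≡ false)
      (position-injective (trans (proj₂ (vertexAt 0 (nonempty G))) (sym (n≤0⇒n≡0 u≤0)))) endpoint∉F
    outsideUpTo (suc k) = outsideUpTo-suc k (outsideUpTo k)

    fort-empty : ⊥
    fort-empty with proj₁ F-fort
    ... | u , Fu with () ← trans (sym Fu) (outsideUpTo (n G) u (<⇒≤ (toℕ<n (σ u))))

  endpoint-inEveryFort : InEveryFort endpoint
  endpoint-inEveryFort F F-fort = ¬-not (fort-empty F F-fort)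

consecutive-sym : ∀ {m} {i j : Fin m} → Consecutive i j ⇔ Consecutive j i
consecutive-sym = mk⇔ swap swap

consecutive-suc : ∀ {m} {i j : Fin m} → Consecutive i j ⇔ Consecutive (suc i) (suc j)
consecutive-suc = mk⇔ (Sum.map (cong suc) (cong suc)) (Sum.map ℕ.suc-injective ℕ.suc-injective)

adj-sym-⇔ : ∀ G {u w} → (adj G u w ≡ true) ⇔ (adj G w u ≡ true)
adj-sym-⇔ G {u} {w} = mk⇔ (trans (adj-sym G w u)) (trans (adj-sym G u w))

module PathFromFortVertex (G : Graph) (v : Fin (n G)) (v∈forts : Forts.InEveryFort G v) where

  irreflexive : ∀ {u} → adj G u u ≢ true
  irreflexive {u} u~u with () ← trans (sym u~u) (irrefl G u)

  -- A path grown from v: vertex (fromℕ k) is v and vertex zero is the free end,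
  -- the only vertex that may have neighbours off the path.
  record Chain (k : ℕ) : Set where
    field
      vertex           : Fin (suc k) → Fin (n G)
      vertex-last      : vertex (fromℕ k) ≡ v
      vertex-injective : Injective _≡_ _≡_ vertex
      adj⇔consecutive  : ∀ i j → (adj G (vertex i) (vertex j) ≡ true) ⇔ Consecutive i j
      interior-closed  : ∀ (i : Fin k) u → adj G (vertex (suc i)) u ≡ true → ∃ λ j → vertex j ≡ u

  trivial : Chain 0
  trivial = record
    { vertex           = λ _ → v
    ; vertex-last      = refl
    ; vertex-injective = λ { {zero} {zero} _ → refl }
    ; adj⇔consecutive  = λ { zero zero → mk⇔ (⊥-elim ∘ irreflexive) λ { (inj₁ ()) ; (inj₂ ()) } }
    ; interior-closed  = λ ()
    }

  module _ {k} (c : Chain k) where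
    open Chain c

    OnChain : Fin (n G) → Set
    OnChain u = ∃ λ j → vertex j ≡ u

    onChain? : ∀ u → Dec (OnChain u)
    onChain? u = any? (λ j → vertex j ≟ᶠ u)

    off : VSet G
    off u = not (does (onChain? u))

    onChain⇒off≡false : ∀ u → OnChain u → off u ≡ false
    onChain⇒off≡false u on = cong not (dec-true (onChain? u) on)

    off≡true⇒¬onChain : ∀ u → off u ≡ true → ¬ OnChain u
    off≡true⇒¬onChain u off-u on with () ← trans (sym off-u) (onChain⇒off≡false u on)

    off≡false⇒onChain : ∀ u → off u ≡ false → OnChain u
    off≡false⇒onChain u off-u = decidable-stable (onChain? u) λ ¬on →
      case trans (sym (cong not (dec-false (onChain? u) ¬on))) off-u of λ ()

    extend : ∀ u → off u ≡ true → adj G (vertex zero) u ≡ true →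
             (∀ w → adj G (vertex zero) w ≡ true → OnChain w ⊎ w ≡ u) → Chain (suc k)
    extend u off-u end~u end-neighbours = record
      { vertex           = vertex′
      ; vertex-last      = vertex-last
      ; vertex-injective = vertex′-injective
      ; adj⇔consecutive  = adj⇔consecutive′
      ; interior-closed  = interior-closed′
      }
      where
      vertex′ : Fin (suc (suc k)) → Fin (n G)
      vertex′ zero    = u
      vertex′ (suc i) = vertex i

      vertex′-injective : Injective _≡_ _≡_ vertex′
      vertex′-injective {zero}  {zero}  _  = refl
      vertex′-injective {zero}  {suc j} u≡ = ⊥-elim (off≡true⇒¬onChain u off-u (j , sym u≡))
      vertex′-injective {suc i} {zero}  ≡u = ⊥-elim (off≡true⇒¬onChain u off-u (i , ≡u))
      vertex′-injective {suc i} {suc j} eq = cong suc (vertex-injective eq)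

      new-end-adj⇔ : ∀ j → (adj G u (vertex′ j) ≡ true) ⇔ Consecutive {suc (suc k)} zero j
      new-end-adj⇔ zero          = mk⇔ (⊥-elim ∘ irreflexive) λ { (inj₁ ()) ; (inj₂ ()) }
      new-end-adj⇔ (suc zero)    = mk⇔ (λ _ → inj₁ refl) (λ _ → Equivalence.to (adj-sym-⇔ G) end~u)
      new-end-adj⇔ (suc (suc j)) = mk⇔ (λ u~ → ⊥-elim (off≡true⇒¬onChain u off-u
                                          (interior-closed j u (Equivalence.to (adj-sym-⇔ G) u~))))
                                        λ { (inj₁ ()) ; (inj₂ ()) }

      adj⇔consecutive′ : ∀ i j → (adj G (vertex′ i) (vertex′ j) ≡ true) ⇔ Consecutive i j
      adj⇔consecutive′ zero    j       = new-end-adj⇔ j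
      adj⇔consecutive′ (suc i) zero    = consecutive-sym ⇔-∘ (new-end-adj⇔ (suc i) ⇔-∘ adj-sym-⇔ G)
      adj⇔consecutive′ (suc i) (suc j) = consecutive-suc ⇔-∘ adj⇔consecutive i j

      interior-closed′ : ∀ (i : Fin (suc k)) w → adj G (vertex′ (suc i)) w ≡ true → ∃ λ j → vertex′ j ≡ w
      interior-closed′ zero w end~w with end-neighbours w end~w
      ... | inj₁ (j , vj≡w) = suc j , vj≡w
      ... | inj₂ w≡u        = zero , sym w≡u
      interior-closed′ (suc i) w vi~w = Product.map suc id (interior-closed i w vi~w)

    all-onChain⇒isPath : (∀ u → OnChain u) → IsPath G
    all-onChain⇒isPath on = σ , σ-injective , σ-adj⇔consecutive
      where
      index : Fin (n G) → Fin (suc k)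
      index u = proj₁ (on u)

      vertex-index : ∀ u → vertex (index u) ≡ u
      vertex-index u = proj₂ (on u)

      index-injective : Injective _≡_ _≡_ index
      index-injective {a} {b} eq = trans (sym (vertex-index a)) (trans (cong vertex eq) (vertex-index b))

      σ : Fin (n G) → Fin (n G)
      σ u = cast (cantor-schröder-bernstein vertex-injective index-injective) (index u)

      toℕ-σ : ∀ u → toℕ (σ u) ≡ toℕ (index u)
      toℕ-σ u = toℕ-cast _ (index u)

      σ-injective : Injective _≡_ _≡_ σ
      σ-injective {a} {b} eq = index-injective (toℕ-injective (trans (sym (toℕ-σ a)) (trans (cong toℕ eq) (toℕ-σ b))))

      σ-adj⇔consecutive : ∀ a b → (adj G a b ≡ true) ⇔ Consecutive (σ a) (σ b)
      σ-adj⇔consecutive a b rewrite toℕ-σ a | toℕ-σ b =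
        subst₂ (λ a′ b′ → (adj G a′ b′ ≡ true) ⇔ Consecutive (index a) (index b))
               (vertex-index a) (vertex-index b) (adj⇔consecutive (index a) (index b))

    end-count : VSet G → ℕ
    end-count F = count (λ w → adj G (vertex zero) w ∧ F w)

    off-isFort : (∃ λ u → off u ≡ true) → end-count off ≢ 1 → IsFort G off
    off-isFort off-nonempty end-count≢1 = off-nonempty , λ u off-u → not-one u (off≡false⇒onChain u off-u)
      where
      not-one : ∀ u → OnChain u → count (λ w → adj G u w ∧ off w) ≢ 1
      not-one _ (zero , refl)  = end-count≢1
      not-one _ (suc i , refl) = λ count≡1 → case trans (sym count≡1) (all-false⇒count≡0 _ interior-off) of λ ()
        where
        interior-off : ∀ w → adj G (vertex (suc i)) w ∧ off w ≡ false
        interior-off w with adj G (vertex (suc i)) w in vi~w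
        ... | true  = onChain⇒off≡false w (interior-closed i w vi~w)
        ... | false = refl

    off-not-fort : ¬ IsFort G off
    off-not-fort off-fort with () ← trans (sym (v∈forts off off-fort))
                                          (onChain⇒off≡false v (fromℕ k , vertex-last))

    grow : IsPath G ⊎ Chain (suc k)
    grow with any? (λ u → off u Bool.≟ true)
    ... | no  none = inj₁ (all-onChain⇒isPath λ u → off≡false⇒onChain u (¬-not λ off-u → none (u , off-u)))
    ... | yes off-nonempty with end-count off ℕ.≟ 1
    ...   | no  end-count≢1 = ⊥-elim (off-not-fort (off-isFort off-nonempty end-count≢1))
    ...   | yes end-count≡1 with count≡1⇒unique _ end-count≡1
    ...     | u , end~u∧off-u , unique =
      inj₂ (extend u (proj₂ (∧≡true⇒ end~u∧off-u)) (proj₁ (∧≡true⇒ end~u∧off-u)) end-neighbours)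
      where
      end-neighbours : ∀ w → adj G (vertex zero) w ≡ true → OnChain w ⊎ w ≡ u
      end-neighbours w end~w with off w in off-w
      ... | false = inj₁ (off≡false⇒onChain w off-w)
      ... | true  = inj₂ (unique w (∧-intro end~w off-w))

  chain⇒isPath : ∀ d {k} → d + suc k ≡ n G → Chain k → IsPath G
  chain⇒isPath zero        d+k≡n c =
    [ id , (λ c′ → ⊥-elim (<-irrefl d+k≡n (injective⇒≤ (Chain.vertex-injective c′)))) ]′ (grow c)
  chain⇒isPath (suc d) {k} d+k≡n c =
    [ id , chain⇒isPath d (trans (+-suc d (suc k)) d+k≡n) ]′ (grow c)

  isPath : IsPath G
  isPath = chain⇒isPath (n G ∸ 1) (m∸n+n≡m (nonempty G)) trivial

proposition3p16 : (G : Graph) → ZStarIsOne G ⇔ IsPath G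
proposition3p16 G = mk⇔
  (λ z* → let v , v∈forts = ZStarIsOne⇒inEveryFort z* in PathFromFortVertex.isPath G v v∈forts)
  (λ (σ , σ-injective , adj⇔consecutive) →
     let open PathEndpoint G σ σ-injective adj⇔consecutive
     in inEveryFort⇒ZStarIsOne endpoint endpoint-inEveryFort)
  where open FractionalZeroForcing G
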